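{- Let $n \geq 3$ and let $v \in A_n$. Then there exist unique elements $v_i \in R_i$, for $3 \leq i \leq n$, such that $v = v_3 v_4 \cdots v_n$.
   Context: $S_n$ is the symmetric group on $[n]=\{1,\dots,n\}$, with composition of permutations as the group operation. $A_n$ is the alternating group, the subgroup of even permutations of $S_n$. For $m \le n$, $S_m$ and $A_m$ are identified with the subgroups of $S_n$ and $A_n$ fixing $m+1,\dots,n$. For $k \geq 3$ define the subset $R_k = \{(1\,2)(j\,k) \mid 1 \leq j < k\} \cup \{e\}$ of $A_k$, where $e$ is the identity permutation and $(a\,b)$ denotes a transposition. -}

module Defs where

open import Data.Nat using (ℕ; zero; suc; _<_; _+_)
open import Data.Fin using (Fin; toℕ)
open import Data.Fin.Permutation using (Permutation′; _∘ₚ_; _≈_; id; transpose)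
open import Data.List using (List; []; _∷_; length)
open import Data.Nat.DivMod using (_%_)
open import Data.Product using (Σ; ∃; _×_; _,_)
open import Data.Sum using (_⊎_)
open import Relation.Binary.PropositionalEquality using (_≡_; _≢_)

-- Group operation of S_n: (σ · τ)(x) = σ (τ x)  (composition, τ applied first).
-- Note stdlib's π₁ ∘ₚ π₂ applies π₁ first.
_·_ : ∀ {n} → Permutation′ n → Permutation′ n → Permutation′ n
σ · τ = τ ∘ₚ σ

infixl 7 _·_

-- Points of [n] are represented by Fin n, with point p ∈ [n] ↦ index p - 1.

Transp : ℕ → Set
Transp n = Σ (Fin n) λ a → Σ (Fin n) λ b → a ≢ b

prodT : ∀ {n} → List (Transp n) → Permutation′ n
prodT [] = id
prodT ((a , b , _) ∷ ts) = transpose a b · prodT ts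

-- Even permutation: a product of an even number of transpositions.
-- A_n is the set of even elements of Permutation′ n.
IsEven : ∀ {n} → Permutation′ n → Set
IsEven {n} σ = Σ (List (Transp n)) λ ts → (length ts % 2 ≡ 0) × (prodT ts ≈ σ)

-- Membership in R_k = {(1 2)(j k) | 1 ≤ j < k} ∪ {e}, viewed inside S_n.
-- In 0-based Fin indices: point 1 ↦ a with toℕ a = 0, point 2 ↦ b with toℕ b = 1,
-- point j ↦ c, point k ↦ d with toℕ d + 1 = k, and j < k means toℕ c < toℕ d.
InR : ∀ {n} → ℕ → Permutation′ n → Set
InR {n} k σ =
  (σ ≈ id) ⊎
  (Σ (Fin n) λ a → Σ (Fin n) λ b → Σ (Fin n) λ c → Σ (Fin n) λ d →
     toℕ a ≡ 0 × toℕ b ≡ 1 × toℕ c < toℕ d × toℕ d + 1 ≡ k ×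
     (σ ≈ transpose a b · transpose c d))

prod3 : ∀ {n} → (ℕ → Permutation′ n) → ℕ → Permutation′ n
prod3 f zero = id
prod3 f (suc zero) = id
prod3 f (suc (suc zero)) = id
prod3 f (suc (suc (suc m))) = prod3 f (suc (suc m)) · f (suc (suc (suc m)))

AllInR : ∀ {n} → ℕ → (ℕ → Permutation′ n) → Set
AllInR {n} m f = ∀ i → 3 Data.Nat.≤ i → i Data.Nat.≤ m → InR {n} i (f i)

module Submission where

-- Points 1, …, n are represented by their indices 0, …, n-1 in Fin n; σ ∈ Sₘ means that σ
-- fixes the points m+1, …, n, i.e. every point of index ≥ m.  Let d be the point of index m,
-- so that Rₘ₊₁ consists of e and the (1 2)(c d) with c < d.
--
-- Existence, by induction on m ("peeling off the last factor"): for w ∈ Aₘ₊₁ ∩ Sₘ₊₁ let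
-- c = w⁻¹(d).  If c = d then w ∈ Sₘ and w = w · e; otherwise c < d, the residual
-- w′ = w (d c)(2 1) is even and fixes d, and w = w′ · (1 2)(c d).  The induction ends at
-- A₂ ∩ S₂ = {e}, i.e. at the fact that (1 2) is odd.  This needs the sign of a permutation σ:
-- the parity of the number of inversions of the sequence σ⁻¹(0), …, σ⁻¹(n-1).  Multiplying σ
-- on the left by a transposition exchanges two entries of this sequence, flipping the parity.
--
-- Uniqueness, by induction on m: v₃ ⋯ vₘ fixes d, so the preimage of d under v₃ ⋯ vₘ₊₁ equals
-- its preimage under vₘ₊₁; an element of Rₘ₊₁ is determined by the preimage of d (it is d for
-- e and c for (1 2)(c d)), so the last factors agree and can be cancelled.

open import Defs
open import Algebra.Bundles using (CommutativeRing; CommutativeMonoid)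
import Algebra.Properties.CommutativeSemigroup as CommutativeSemigroupProperties
open import Data.Bool using (Bool; false; not; _xor_)
open import Data.Bool.Properties
  using (xor-∧-commutativeRing; not-involutive; not-distribˡ-xor; not-distribʳ-xor; not-¬)
open import Data.Empty using (⊥-elim)
open import Data.Fin using (Fin; toℕ; fromℕ<; suc; _≟_)
open import Data.Fin.Patterns using (0F; 1F)
open import Data.Fin.Permutation
  using (Permutation′; _≈_; id; transpose; _⟨$⟩ʳ_; _⟨$⟩ˡ_; inverseˡ; inverseʳ)
import Data.Fin.Permutation.Components as PC
open import Data.Fin.Properties using (toℕ-injective; toℕ-fromℕ<; toℕ<n)
open import Data.List using (List; []; _∷_; _++_; [_]; map; allFin; length)
open import Data.List.Properties using (map-++; map-∘; map-cong; map-id-local; ++-assoc; length-++)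
open import Data.List.Membership.Propositional using (_∈_)
open import Data.List.Membership.Propositional.Properties using (∈-∃++; ∈-++⁻; ∈-allFin)
open import Data.List.Relation.Unary.All as All using (All; []; _∷_)
import Data.List.Relation.Unary.All.Properties as All
open import Data.List.Relation.Unary.Any using (here; there)
open import Data.List.Relation.Unary.AllPairs using (_∷_)
open import Data.List.Relation.Unary.Unique.Propositional using (Unique)
open import Data.List.Relation.Unary.Unique.Propositional.Properties using (allFin⁺)
open import Data.Nat using (ℕ; zero; suc; _+_; _≤_; _<_; _<ᵇ_; _<?_; _≤?_; z≤n; s≤s; s≤s⁻¹; _%_)
  renaming (_≟_ to _≟ℕ_)
open import Data.Nat.DivMod using ([m+n]%n≡m%n)
open import Data.Nat.Properties
  using ( <-cmp; +-comm; ≤-refl; ≤-trans; ≤-reflexive; ≤-<-trans; <-trans; <-irrefl; <⇒≢; <⇒≱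
        ; ≰⇒>; ≤∧≢⇒<; m≤m+n; n≤1+n; m≤n⇒m≤1+n; m≤n⇒m<n∨m≡n; suc-injective)
open import Data.Product using (Σ; _×_; _,_; proj₁; proj₂)
open import Data.Sum using (_⊎_; inj₁; inj₂; [_,_]′)
open import Function using (_∘_)
open import Relation.Binary using (tri<; tri≈; tri>)
open import Relation.Binary.PropositionalEquality
  using (_≡_; _≢_; refl; sym; trans; cong; cong₂; subst; ≢-sym; module ≡-Reasoning)
open import Relation.Nullary using (¬_; yes; no)
open import Relation.Nullary.Decidable using (dec-true; dec-false)

open ≡-Reasoning

open CommutativeSemigroupProperties
  (CommutativeMonoid.commutativeSemigroup
    (CommutativeRing.+-commutativeMonoid xor-∧-commutativeRing))
  using (interchange; x∙yz≈y∙xz)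

below : ℕ → List ℕ → Bool
below x []      = false
below x (y ∷ l) = (y <ᵇ x) xor below x l

inversions : List ℕ → Bool
inversions []      = false
inversions (y ∷ l) = below y l xor inversions l

<ᵇ-flip : ∀ {u v} → u ≢ v → (v <ᵇ u) ≡ not (u <ᵇ v)
<ᵇ-flip {u} {v} u≢v with <-cmp u v
... | tri< u<v _ v≮u rewrite dec-true (u <? v) u<v | dec-false (v <? u) v≮u = refl
... | tri≈ _ u≡v _   = ⊥-elim (u≢v u≡v)
... | tri> u≮v _ v<u rewrite dec-false (u <? v) u≮v | dec-true (v <? u) v<u = refl

below-adjacent-swap : ∀ x P u v Q → below x (P ++ u ∷ v ∷ Q) ≡ below x (P ++ v ∷ u ∷ Q)
below-adjacent-swap x []      u v Q = x∙yz≈y∙xz (u <ᵇ x) (v <ᵇ x) (below x Q)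
below-adjacent-swap x (p ∷ P) u v Q = cong ((p <ᵇ x) xor_) (below-adjacent-swap x P u v Q)

-- Exchanging two adjacent distinct entries changes exactly one pair, so it flips the parity.
inversions-adjacent-swap : ∀ P {u v} Q → u ≢ v →
  inversions (P ++ u ∷ v ∷ Q) ≡ not (inversions (P ++ v ∷ u ∷ Q))
inversions-adjacent-swap [] {u} {v} Q u≢v = begin
  ((v <ᵇ u) xor below u Q) xor (below v Q xor inversions Q)
    ≡⟨ cong (λ b → (b xor below u Q) xor (below v Q xor inversions Q)) (<ᵇ-flip u≢v) ⟩
  (not (u <ᵇ v) xor below u Q) xor (below v Q xor inversions Q)
    ≡⟨ cong (_xor (below v Q xor inversions Q)) (sym (not-distribˡ-xor (u <ᵇ v) (below u Q))) ⟩
  not ((u <ᵇ v) xor below u Q) xor (below v Q xor inversions Q)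
    ≡⟨ sym (not-distribˡ-xor ((u <ᵇ v) xor below u Q) (below v Q xor inversions Q)) ⟩
  not (((u <ᵇ v) xor below u Q) xor (below v Q xor inversions Q))
    ≡⟨ cong not (interchange (u <ᵇ v) (below u Q) (below v Q) (inversions Q)) ⟩
  not (((u <ᵇ v) xor below v Q) xor (below u Q xor inversions Q)) ∎
inversions-adjacent-swap (p ∷ P) {u} {v} Q u≢v = begin
  below p (P ++ u ∷ v ∷ Q) xor inversions (P ++ u ∷ v ∷ Q)
    ≡⟨ cong₂ _xor_ (below-adjacent-swap p P u v Q) (inversions-adjacent-swap P Q u≢v) ⟩
  below p (P ++ v ∷ u ∷ Q) xor not (inversions (P ++ v ∷ u ∷ Q))
    ≡⟨ sym (not-distribʳ-xor (below p (P ++ v ∷ u ∷ Q)) (inversions (P ++ v ∷ u ∷ Q))) ⟩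
  not (below p (P ++ v ∷ u ∷ Q) xor inversions (P ++ v ∷ u ∷ Q)) ∎

Avoids : {A : Set} → A → A → A → Set
Avoids x y z = z ≢ x × z ≢ y

-- Exchanging two distinct entries x, y whose in-between entries differ from both flips the
-- parity: the exchange is a composite of 2|M| + 1 adjacent exchanges of distinct entries.
inversions-swap : ∀ P {x y} M Q → x ≢ y → All (Avoids x y) M →
  inversions (P ++ x ∷ M ++ y ∷ Q) ≡ not (inversions (P ++ y ∷ M ++ x ∷ Q))
inversions-swap P []      Q x≢y [] = inversions-adjacent-swap P Q x≢y
inversions-swap P {x} {y} (m ∷ M) Q x≢y ((m≢x , m≢y) ∷ M-avoids) = begin
  inversions (P ++ x ∷ m ∷ M ++ y ∷ Q)
    ≡⟨ inversions-adjacent-swap P (M ++ y ∷ Q) (≢-sym m≢x) ⟩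
  not (inversions (P ++ m ∷ x ∷ M ++ y ∷ Q))
    ≡⟨ cong (not ∘ inversions) (sym (++-assoc P [ m ] (x ∷ M ++ y ∷ Q))) ⟩
  not (inversions ((P ++ [ m ]) ++ x ∷ M ++ y ∷ Q))
    ≡⟨ cong not (inversions-swap (P ++ [ m ]) M Q x≢y M-avoids) ⟩
  not (not (inversions ((P ++ [ m ]) ++ y ∷ M ++ x ∷ Q)))
    ≡⟨ cong (not ∘ not ∘ inversions) (++-assoc P [ m ] (y ∷ M ++ x ∷ Q)) ⟩
  not (not (inversions (P ++ m ∷ y ∷ M ++ x ∷ Q)))
    ≡⟨ cong (not ∘ not) (inversions-adjacent-swap P (M ++ x ∷ Q) m≢y) ⟩
  not (not (not (inversions (P ++ y ∷ m ∷ M ++ x ∷ Q))))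
    ≡⟨ not-involutive _ ⟩
  not (inversions (P ++ y ∷ m ∷ M ++ x ∷ Q)) ∎

module _ {A : Set} where

  unique-split : ∀ P {x : A} {R} → Unique (P ++ x ∷ R) → All (_≢ x) P × All (_≢ x) R
  unique-split []      (x≢R ∷ _) = [] , All.map ≢-sym x≢R
  unique-split (p ∷ P) (p≢ ∷ U)  =
    All.head (All.++⁻ʳ P p≢) ∷ proj₁ (unique-split P U) , proj₂ (unique-split P U)

  unique-separated : ∀ P {u : A} M {v} Q → Unique (P ++ u ∷ M ++ v ∷ Q) →
    u ≢ v × All (Avoids u v) P × All (Avoids u v) M × All (Avoids u v) Q
  unique-separated P {u} M {v} Q U =
    ≢-sym (All.head v∷Q≢u) , All.zip (P≢u , P≢v) , All.zip (M≢u , All.tail u∷M≢v)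
      , All.zip (All.tail v∷Q≢u , Q≢v)
    where
    P≢u = proj₁ (unique-split P U)
    M≢u = proj₁ (All.++⁻ M (proj₂ (unique-split P U)))
    v∷Q≢u = proj₂ (All.++⁻ M (proj₂ (unique-split P U)))
    split-v = unique-split (P ++ u ∷ M) (subst Unique (sym (++-assoc P (u ∷ M) (v ∷ Q))) U)
    Q≢v = proj₂ split-v
    P≢v = proj₁ (All.++⁻ P (proj₁ split-v))
    u∷M≢v = proj₂ (All.++⁻ P (proj₁ split-v))

  Exchanges : (A → A) → A → A → Set
  Exchanges τ u v = τ u ≡ v × τ v ≡ u × (∀ z → Avoids u v z → τ z ≡ z)

  exchanges-sym : ∀ {τ u v} → Exchanges τ u v → Exchanges τ v u
  exchanges-sym (τu , τv , τz) = τv , τu , λ z (z≢v , z≢u) → τz z (z≢u , z≢v)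

  map-split : ∀ {B : Set} (f : A → B) P u M v Q →
    map f (P ++ u ∷ M ++ v ∷ Q) ≡ map f P ++ f u ∷ map f M ++ f v ∷ map f Q
  map-split f P u M v Q = trans (map-++ f P _) (cong (λ R → map f P ++ f u ∷ R) (map-++ f M _))

  map-exchange : ∀ {τ u v} P M Q → Exchanges τ u v →
    All (Avoids u v) P → All (Avoids u v) M → All (Avoids u v) Q →
    map τ (P ++ u ∷ M ++ v ∷ Q) ≡ P ++ v ∷ M ++ u ∷ Q
  map-exchange {τ} {u} {v} P M Q (τu , τv , τz) P-av M-av Q-av = begin
    map τ (P ++ u ∷ M ++ v ∷ Q)                ≡⟨ map-split τ P u M v Q ⟩
    map τ P ++ τ u ∷ map τ M ++ τ v ∷ map τ Q  ≡⟨ cong₂ _++_ (fixed P-av)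
                                                   (cong₂ _∷_ τu (cong₂ _++_ (fixed M-av)
                                                     (cong₂ _∷_ τv (fixed Q-av)))) ⟩
    P ++ v ∷ M ++ u ∷ Q                        ∎
    where
    fixed : ∀ {L} → All (Avoids u v) L → map τ L ≡ L
    fixed L-av = map-id-local (All.map (τz _) L-av)

  inversions-exchange-split : ∀ (g : A → ℕ) → (∀ {x y} → g x ≡ g y → x ≡ y) →
    ∀ {τ} P {u} M {v} Q → Unique (P ++ u ∷ M ++ v ∷ Q) → Exchanges τ u v →
    inversions (map (g ∘ τ) (P ++ u ∷ M ++ v ∷ Q))
      ≡ not (inversions (map g (P ++ u ∷ M ++ v ∷ Q)))
  inversions-exchange-split g g-inj {τ} P {u} M {v} Q U ex = begin
    inversions (map (g ∘ τ) L)
      ≡⟨ cong inversions (map-∘ L) ⟩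
    inversions (map g (map τ L))
      ≡⟨ cong (inversions ∘ map g) (map-exchange P M Q ex P-av M-av Q-av) ⟩
    inversions (map g (P ++ v ∷ M ++ u ∷ Q))
      ≡⟨ cong inversions (map-split g P v M u Q) ⟩
    inversions (map g P ++ g v ∷ map g M ++ g u ∷ map g Q)
      ≡⟨ inversions-swap (map g P) (map g M) (map g Q) (λ e → u≢v (sym (g-inj e))) gM-av ⟩
    not (inversions (map g P ++ g u ∷ map g M ++ g v ∷ map g Q))
      ≡⟨ cong (not ∘ inversions) (sym (map-split g P u M v Q)) ⟩
    not (inversions (map g L))
      ∎
    where
    L = P ++ u ∷ M ++ v ∷ Q
    separated = unique-separated P M Q U
    u≢v = proj₁ separated
    P-av = proj₁ (proj₂ separated)
    M-av = proj₁ (proj₂ (proj₂ separated))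
    Q-av = proj₂ (proj₂ (proj₂ separated))
    gM-av : All (Avoids (g v) (g u)) (map g M)
    gM-av = All.map⁺ (All.map (λ (z≢u , z≢v) → z≢v ∘ g-inj , z≢u ∘ g-inj) M-av)

  inversions-exchange : ∀ (g : A → ℕ) → (∀ {x y} → g x ≡ g y → x ≡ y) →
    ∀ {τ L u v} → Unique L → u ∈ L → v ∈ L → u ≢ v → Exchanges τ u v →
    inversions (map (g ∘ τ) L) ≡ not (inversions (map g L))
  inversions-exchange g g-inj {u = u} {v} U u∈L v∈L u≢v ex with ∈-∃++ u∈L
  ... | P , R , refl with ∈-++⁻ P v∈L
  ...   | inj₂ (here v≡u)  = ⊥-elim (u≢v (sym v≡u))
  ...   | inj₂ (there v∈R) with ∈-∃++ v∈R
  ...     | M , Q , refl = inversions-exchange-split g g-inj P M Q U ex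
  inversions-exchange g g-inj {u = u} {v} U u∈L v∈L u≢v ex | P , R , refl | inj₁ v∈P
    with ∈-∃++ v∈P
  ...     | P₁ , M , refl rewrite ++-assoc P₁ (v ∷ M) (u ∷ R) =
    inversions-exchange-split g g-inj P₁ M R U (exchanges-sym ex)

extend : ∀ {A : Set} → (ℕ → A) → ℕ → A → ℕ → A
extend f k r i with i ≟ℕ k
... | yes _ = r
... | no _  = f i

extend-at : ∀ {A : Set} (f : ℕ → A) k r → extend f k r k ≡ r
extend-at f k r with k ≟ℕ k
... | yes _  = refl
... | no k≢k = ⊥-elim (k≢k refl)

extend-other : ∀ {A : Set} (f : ℕ → A) k r {i} → i ≢ k → extend f k r i ≡ f i
extend-other f k r {i} i≢k with i ≟ℕ k
... | yes i≡k = ⊥-elim (i≢k i≡k)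
... | no _    = refl

module _ {n : ℕ} where

  ⟨$⟩ʳ-injective : ∀ (σ : Permutation′ n) {x y} → σ ⟨$⟩ʳ x ≡ σ ⟨$⟩ʳ y → x ≡ y
  ⟨$⟩ʳ-injective σ {x} {y} e = begin
    x                        ≡⟨ sym (inverseˡ σ) ⟩
    σ ⟨$⟩ˡ (σ ⟨$⟩ʳ x)        ≡⟨ cong (σ ⟨$⟩ˡ_) e ⟩
    σ ⟨$⟩ˡ (σ ⟨$⟩ʳ y)        ≡⟨ inverseˡ σ ⟩
    y                        ∎

  ⟨$⟩ˡ-injective : ∀ (σ : Permutation′ n) {x y} → σ ⟨$⟩ˡ x ≡ σ ⟨$⟩ˡ y → x ≡ y
  ⟨$⟩ˡ-injective σ {x} {y} e = trans (sym (inverseʳ σ)) (trans (cong (σ ⟨$⟩ʳ_) e) (inverseʳ σ))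

  ≈-inverse : ∀ (σ τ : Permutation′ n) → σ ≈ τ → ∀ x → σ ⟨$⟩ˡ x ≡ τ ⟨$⟩ˡ x
  ≈-inverse σ τ σ≈τ x =
    ⟨$⟩ʳ-injective τ (trans (sym (σ≈τ (σ ⟨$⟩ˡ x))) (trans (inverseʳ σ) (sym (inverseʳ τ))))

  fixed-by-inverse : ∀ (σ : Permutation′ n) {x} → σ ⟨$⟩ʳ x ≡ x → σ ⟨$⟩ˡ x ≡ x
  fixed-by-inverse σ σx≡x = trans (cong (σ ⟨$⟩ˡ_) (sym σx≡x)) (inverseˡ σ)

  ·-cancelʳ : ∀ {σ τ ρ ρ′ : Permutation′ n} → σ · ρ ≈ τ · ρ′ → ρ ≈ ρ′ → σ ≈ τ
  ·-cancelʳ {σ} {τ} {ρ} {ρ′} σρ≈τρ′ ρ≈ρ′ x = begin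
    σ ⟨$⟩ʳ x                     ≡⟨ cong (σ ⟨$⟩ʳ_) (sym (inverseʳ ρ)) ⟩
    σ ⟨$⟩ʳ (ρ ⟨$⟩ʳ (ρ ⟨$⟩ˡ x))   ≡⟨ σρ≈τρ′ (ρ ⟨$⟩ˡ x) ⟩
    τ ⟨$⟩ʳ (ρ′ ⟨$⟩ʳ (ρ ⟨$⟩ˡ x))  ≡⟨ cong (τ ⟨$⟩ʳ_) (sym (ρ≈ρ′ (ρ ⟨$⟩ˡ x))) ⟩
    τ ⟨$⟩ʳ (ρ ⟨$⟩ʳ (ρ ⟨$⟩ˡ x))   ≡⟨ cong (τ ⟨$⟩ʳ_) (inverseʳ ρ) ⟩
    τ ⟨$⟩ʳ x                     ∎

  transpose-matchˡ : ∀ (i j : Fin n) → PC.transpose i j i ≡ j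
  transpose-matchˡ i j with i ≟ i
  ... | yes _   = refl
  ... | no i≢i  = ⊥-elim (i≢i refl)

  transpose-matchʳ : ∀ (i j : Fin n) → PC.transpose i j j ≡ i
  transpose-matchʳ i j with j ≟ i
  ... | yes j≡i = j≡i
  ... | no _ with j ≟ j
  ...   | yes _   = refl
  ...   | no j≢j  = ⊥-elim (j≢j refl)

  transpose-fixes : ∀ {i j z : Fin n} → z ≢ i → z ≢ j → PC.transpose i j z ≡ z
  transpose-fixes {i} {j} {z} z≢i z≢j with z ≟ i
  ... | yes z≡i = ⊥-elim (z≢i z≡i)
  ... | no _ with z ≟ j
  ...   | yes z≡j = ⊥-elim (z≢j z≡j)
  ...   | no _    = refl

  transpose-exchanges : ∀ (i j : Fin n) → Exchanges (PC.transpose i j) i j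
  transpose-exchanges i j =
    transpose-matchˡ i j , transpose-matchʳ i j , λ z (z≢i , z≢j) → transpose-fixes z≢i z≢j

  above⇒≢ : ∀ {x y : Fin n} → toℕ y < toℕ x → x ≢ y
  above⇒≢ y<x refl = <-irrefl refl y<x

  sign : Permutation′ n → Bool
  sign σ = inversions (map (λ i → toℕ (σ ⟨$⟩ˡ i)) (allFin n))

  sign-cong : ∀ (σ τ : Permutation′ n) → σ ≈ τ → sign σ ≡ sign τ
  sign-cong σ τ σ≈τ = cong inversions (map-cong (λ i → cong toℕ (≈-inverse σ τ σ≈τ i)) (allFin n))

  -- The sequence of (a b)π is that of π with the entries at positions a and b exchanged,
  -- so multiplying by a transposition on the left flips the sign.
  sign-transpose : ∀ {a b : Fin n} → a ≢ b → (π : Permutation′ n) →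
    sign (transpose a b · π) ≡ not (sign π)
  sign-transpose {a} {b} a≢b π =
    inversions-exchange (λ i → toℕ (π ⟨$⟩ˡ i)) (⟨$⟩ˡ-injective π ∘ toℕ-injective)
      (allFin⁺ n) (∈-allFin b) (∈-allFin a) (≢-sym a≢b) (transpose-exchanges b a)

  sign-prodT : ∀ ts → length ts % 2 ≡ 0 → sign (prodT {n} ts) ≡ sign id
  sign-prodT []                                      _  = refl
  sign-prodT (_ ∷ [])                                ()
  sign-prodT ((a , b , a≢b) ∷ (c , d , c≢d) ∷ ts) ev = begin
    sign (transpose a b · (transpose c d · prodT ts))
      ≡⟨ sign-transpose a≢b (transpose c d · prodT ts) ⟩
    not (sign (transpose c d · prodT ts))
      ≡⟨ cong not (sign-transpose c≢d (prodT ts)) ⟩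
    not (not (sign (prodT ts)))
      ≡⟨ not-involutive _ ⟩
    sign (prodT ts)
      ≡⟨ sign-prodT ts ev ⟩
    sign id
      ∎

  sign-even : ∀ {σ : Permutation′ n} → IsEven σ → sign σ ≡ sign id
  sign-even {σ} (ts , ev , ts≈σ) = trans (sym (sign-cong (prodT ts) σ ts≈σ)) (sign-prodT ts ev)

  transposition-odd : ∀ {a b : Fin n} {σ} → a ≢ b → σ ≈ transpose a b → ¬ IsEven σ
  transposition-odd {a} {b} {σ} a≢b σ≈t σ-even =
    not-¬ (trans (sym (sign-cong σ (transpose a b) σ≈t)) (sign-even {σ} σ-even))
          (sign-transpose a≢b id)

  prodT-++ : ∀ (ts us : List (Transp n)) → prodT (ts ++ us) ≈ prodT ts · prodT us
  prodT-++ []                  us x = refl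
  prodT-++ ((a , b , _) ∷ ts) us x = cong (PC.transpose a b) (prodT-++ ts us x)

  even-·-transpositions : ∀ {w : Permutation′ n} {a b c d} → IsEven w → a ≢ b → c ≢ d →
    IsEven (w · transpose a b · transpose c d)
  even-·-transpositions {a = a} {b} {c} {d} (ts , ev , ts≈w) a≢b c≢d =
    ts ++ us , even-length , λ x → trans (prodT-++ ts us x) (ts≈w _)
    where
    us = (a , b , a≢b) ∷ (c , d , c≢d) ∷ []
    even-length : length (ts ++ us) % 2 ≡ 0
    even-length = trans (cong (_% 2) (length-++ ts)) (trans ([m+n]%n≡m%n (length ts) 2) ev)

  InSym : ℕ → Permutation′ n → Set
  InSym m σ = ∀ x → m ≤ toℕ x → σ ⟨$⟩ʳ x ≡ x

  InSym-all : ∀ σ → InSym n σ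
  InSym-all σ x n≤x = ⊥-elim (<⇒≱ (toℕ<n x) n≤x)

  InSym-step : ∀ {m σ} (d : Fin n) → toℕ d ≡ m → InSym (suc m) σ → σ ⟨$⟩ʳ d ≡ d → InSym m σ
  InSym-step d d≡m σ∈S σd≡d x m≤x with m≤n⇒m<n∨m≡n m≤x
  ... | inj₁ m<x = σ∈S x m<x
  ... | inj₂ m≡x rewrite toℕ-injective {i = x} {j = d} (trans (sym m≡x) (sym d≡m)) = σd≡d

  -- Rₖ ⊆ Sₖ: the points moved by (1 2)(c d) have index at most d < k.
  R⊆S : ∀ {k r} → InR k r → InSym k r
  R⊆S (inj₁ r≈id) x _ = r≈id x
  R⊆S {r = r} (inj₂ (a , b , c , d , a≡0 , b≡1 , c<d , d+1≡k , r≈)) x k≤x = begin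
    r ⟨$⟩ʳ x                                ≡⟨ r≈ x ⟩
    PC.transpose a b (PC.transpose c d x)   ≡⟨ cong (PC.transpose a b) (transpose-fixes x≢c x≢d) ⟩
    PC.transpose a b x                      ≡⟨ transpose-fixes x≢a x≢b ⟩
    x                                       ∎
    where
    d<x : toℕ d < toℕ x
    d<x = ≤-trans (≤-reflexive (trans (+-comm 1 (toℕ d)) d+1≡k)) k≤x
    1<x : 1 < toℕ x
    1<x = ≤-<-trans (≤-trans (s≤s z≤n) c<d) d<x
    x≢a = above⇒≢ (subst (_< toℕ x) (sym a≡0) (<-trans (s≤s z≤n) 1<x))
    x≢b = above⇒≢ (subst (_< toℕ x) (sym b≡1) 1<x)
    x≢c = above⇒≢ (<-trans c<d d<x)
    x≢d = above⇒≢ d<x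

  AllInR-restrict : ∀ {m f} → AllInR {n} (suc m) f → AllInR m f
  AllInR-restrict f∈R i 3≤i i≤m = f∈R i 3≤i (m≤n⇒m≤1+n i≤m)

  -- v₃ ⋯ vₘ ∈ Sₘ, since each factor vᵢ lies in Rᵢ ⊆ Sᵢ ⊆ Sₘ.
  prod3∈S : ∀ m {f} → AllInR {n} m f → InSym m (prod3 f m)
  prod3∈S zero                _    x _   = refl
  prod3∈S (suc zero)          _    x _   = refl
  prod3∈S (suc (suc zero))    _    x _   = refl
  prod3∈S (suc (suc (suc m))) {f} f∈R x m≤x = begin
    prod3 f (2 + m) ⟨$⟩ʳ (f (3 + m) ⟨$⟩ʳ x)
      ≡⟨ cong (prod3 f (2 + m) ⟨$⟩ʳ_) (R⊆S {r = f (3 + m)} (f∈R (3 + m) (m≤m+n 3 m) ≤-refl) x m≤x) ⟩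
    prod3 f (2 + m) ⟨$⟩ʳ x
      ≡⟨ prod3∈S (suc (suc m)) (AllInR-restrict {f = f} f∈R) x (≤-trans (n≤1+n _) m≤x) ⟩
    x
      ∎

  prod3-cong : ∀ m {f g : ℕ → Permutation′ n} → (∀ i → i ≤ m → f i ≡ g i) → prod3 f m ≡ prod3 g m
  prod3-cong zero                _ = refl
  prod3-cong (suc zero)          _ = refl
  prod3-cong (suc (suc zero))    _ = refl
  prod3-cong (suc (suc (suc m))) f≡g =
    cong₂ _·_ (prod3-cong (suc (suc m)) (λ i i≤ → f≡g i (m≤n⇒m≤1+n i≤))) (f≡g (3 + m) ≤-refl)

  AllInR-extend : ∀ k {f r} → AllInR {n} k f → InR (suc k) r → AllInR (suc k) (extend f (suc k) r)
  AllInR-extend k {f} {r} f∈R r∈R i 3≤i i≤k+1 with m≤n⇒m<n∨m≡n i≤k+1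
  ... | inj₁ (s≤s i≤k) =
    subst (InR i) (sym (extend-other f (suc k) r (<⇒≢ (s≤s i≤k)))) (f∈R i 3≤i i≤k)
  ... | inj₂ refl      = subst (InR (suc k)) (sym (extend-at f (suc k) r)) r∈R

  prod3-extend : ∀ m (f : ℕ → Permutation′ n) r →
    prod3 (extend f (3 + m) r) (3 + m) ≡ prod3 f (2 + m) · r
  prod3-extend m f r =
    cong₂ _·_ (prod3-cong (2 + m) (λ i i≤ → extend-other f (3 + m) r (<⇒≢ (s≤s i≤))))
              (extend-at f (3 + m) r)

module _ {n : ℕ} where

  private
    N : ℕ
    N = suc (suc n)

  rElem : Fin N → Fin N → Permutation′ N
  rElem c d = transpose 0F 1F · transpose c d

  rElem∈R : ∀ {m} {c d : Fin N} → toℕ d ≡ m → toℕ c < toℕ d → InR (suc m) (rElem c d)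
  rElem∈R {c = c} {d} d≡m c<d =
    inj₂ (0F , 1F , c , d , refl , refl , c<d , trans (+-comm (toℕ d) 1) (cong suc d≡m)
         , λ _ → refl)

  R-normal : ∀ {m r} (d : Fin N) → toℕ d ≡ m → InR (suc m) r →
    r ≈ id ⊎ Σ (Fin N) λ c → toℕ c < toℕ d × r ≈ rElem c d
  R-normal d d≡m (inj₁ r≈id) = inj₁ r≈id
  R-normal d d≡m (inj₂ (a , b , c , d′ , a≡0 , b≡1 , c<d′ , d′+1≡m+1 , r≈))
    with toℕ-injective {i = a} {j = 0F} a≡0 | toℕ-injective {i = b} {j = 1F} b≡1
       | toℕ-injective {i = d′} {j = d} (trans d′≡m (sym d≡m))
    where
    d′≡m = suc-injective (trans (+-comm 1 (toℕ d′)) d′+1≡m+1)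
  ... | refl | refl | refl = inj₂ (c , c<d′ , r≈)

  -- The preimage of d under (1 2)(c d) is c, as d ∉ {1, 2}.
  rElem-preimage : ∀ {c d : Fin N} → 2 ≤ toℕ d → rElem c d ⟨$⟩ˡ d ≡ c
  rElem-preimage {c} {d} 2≤d =
    trans (cong (PC.transpose d c) (transpose-fixes d≢1 d≢0)) (transpose-matchˡ d c)
    where
    d≢1 = above⇒≢ 2≤d
    d≢0 = above⇒≢ (≤-trans (s≤s z≤n) 2≤d)

  rElem-preimage≈ : ∀ t {c d : Fin N} → 2 ≤ toℕ d → t ≈ rElem c d → t ⟨$⟩ˡ d ≡ c
  rElem-preimage≈ t {c} {d} 2≤d t≈ = trans (≈-inverse t (rElem c d) t≈ d) (rElem-preimage 2≤d)

  -- An element r of Rₘ₊₁ is determined by r⁻¹(d): it is d for e and c for (1 2)(c d).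
  R-determined : ∀ {m} (r s : Permutation′ N) (d : Fin N) → toℕ d ≡ m → 2 ≤ toℕ d →
    InR (suc m) r → InR (suc m) s → r ⟨$⟩ˡ d ≡ s ⟨$⟩ˡ d → r ≈ s
  R-determined r s d d≡m 2≤d r∈R s∈R r⁻¹d≡s⁻¹d
    with R-normal {r = r} d d≡m r∈R | R-normal {r = s} d d≡m s∈R
  ... | inj₁ r≈id | inj₁ s≈id = λ x → trans (r≈id x) (sym (s≈id x))
  ... | inj₁ r≈id | inj₂ (c , c<d , s≈) = ⊥-elim (above⇒≢ c<d (begin
    d          ≡⟨ sym (≈-inverse r id r≈id d) ⟩
    r ⟨$⟩ˡ d   ≡⟨ r⁻¹d≡s⁻¹d ⟩
    s ⟨$⟩ˡ d   ≡⟨ rElem-preimage≈ s 2≤d s≈ ⟩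
    c          ∎))
  ... | inj₂ (c , c<d , r≈) | inj₁ s≈id = ⊥-elim (above⇒≢ c<d (begin
    d          ≡⟨ sym (≈-inverse s id s≈id d) ⟩
    s ⟨$⟩ˡ d   ≡⟨ sym r⁻¹d≡s⁻¹d ⟩
    r ⟨$⟩ˡ d   ≡⟨ rElem-preimage≈ r 2≤d r≈ ⟩
    c          ∎))
  ... | inj₂ (c , _ , r≈) | inj₂ (c′ , _ , s≈) = λ x → begin
    r ⟨$⟩ʳ x           ≡⟨ r≈ x ⟩
    rElem c d ⟨$⟩ʳ x   ≡⟨ cong (λ e → rElem e d ⟨$⟩ʳ x) c≡c′ ⟩
    rElem c′ d ⟨$⟩ʳ x  ≡⟨ sym (s≈ x) ⟩
    s ⟨$⟩ʳ x           ∎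
    where
    c≡c′ = trans (sym (rElem-preimage≈ r 2≤d r≈)) (trans r⁻¹d≡s⁻¹d (rElem-preimage≈ s 2≤d s≈))

  -- A₂ ∩ S₂ = {e}: a permutation in S₂ permutes the points 1, 2, and if it is even it cannot
  -- exchange them, since transpositions are odd.
  even-in-S₂-is-id : ∀ {w : Permutation′ N} → IsEven w → InSym 2 w → w ≈ id
  even-in-S₂-is-id {w = w} w-even w∈S with w ⟨$⟩ʳ 0F in w0 | w ⟨$⟩ʳ 1F in w1
  ... | 0F | 1F = λ { 0F → w0 ; 1F → w1 ; x@(suc (suc _)) → w∈S x (s≤s (s≤s z≤n)) }
  ... | 1F | 0F = ⊥-elim (transposition-odd {σ = w} (λ ()) w≈t₀₁ w-even)
    where
    w≈t₀₁ : w ≈ transpose 0F 1F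
    w≈t₀₁ 0F                 = w0
    w≈t₀₁ 1F                 = w1
    w≈t₀₁ x@(suc (suc _))    = w∈S x (s≤s (s≤s z≤n))
  ... | 0F | 0F with () ← ⟨$⟩ʳ-injective w (trans w0 (sym w1))
  ... | 1F | 1F with () ← ⟨$⟩ʳ-injective w (trans w0 (sym w1))
  ... | x@(suc (suc _)) | _ with () ← ⟨$⟩ʳ-injective w (trans w0 (sym (w∈S x (s≤s (s≤s z≤n)))))
  ... | _ | x@(suc (suc _)) with () ← ⟨$⟩ʳ-injective w (trans w1 (sym (w∈S x (s≤s (s≤s z≤n)))))

  record Peeling (m : ℕ) (w : Permutation′ N) : Set where
    constructor peeling
    field
      rest         : Permutation′ N
      last         : Permutation′ N
      rest-even    : IsEven rest
      rest∈S       : InSym m rest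
      last∈R       : InR (suc m) last
      factorises   : rest · last ≈ w

  -- If w ∈ Sₘ₊₁ moves the point d of index m, then c = w⁻¹(d) lies below d: points of index
  -- greater than m are fixed by w, so they are not mapped to d.
  preimage-below : ∀ {m} (w : Permutation′ N) (d : Fin N) → toℕ d ≡ m → InSym (suc m) w →
    w ⟨$⟩ˡ d ≢ d → toℕ (w ⟨$⟩ˡ d) < toℕ d
  preimage-below {m} w d d≡m w∈S c≢d with toℕ (w ⟨$⟩ˡ d) ≤? m
  ... | yes c≤m = ≤∧≢⇒< (subst (toℕ (w ⟨$⟩ˡ d) ≤_) (sym d≡m) c≤m) (c≢d ∘ toℕ-injective)
  ... | no c≰m  = ⊥-elim (c≢d (trans (sym (w∈S (w ⟨$⟩ˡ d) (≰⇒> c≰m))) (inverseʳ w)))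

  residual : Permutation′ N → Fin N → Fin N → Permutation′ N
  residual w c d = w · transpose d c · transpose 1F 0F

  residual-factorises : ∀ (w : Permutation′ N) c d → residual w c d · rElem c d ≈ w
  residual-factorises w c d x =
    cong (w ⟨$⟩ʳ_) (trans (cong (PC.transpose d c) (PC.transpose-inverse 1F 0F {PC.transpose c d x}))
                          (PC.transpose-inverse d c {x}))

  -- If w ∈ Sₘ₊₁ maps c < d to the point d of index m ≥ 2, the residual lies in Sₘ: it fixes d,
  -- and the points of index greater than m avoid 1, 2, c and d.
  residual∈S : ∀ {m} (w : Permutation′ N) {c d : Fin N} → toℕ d ≡ m → 2 ≤ toℕ d → toℕ c < toℕ d →
    w ⟨$⟩ʳ c ≡ d → InSym (suc m) w → InSym m (residual w c d)
  residual∈S {m} w {c} {d} d≡m 2≤d c<d wc≡d w∈S =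
    InSym-step {σ = residual w c d} d d≡m moved-fixed d-fixed
    where
    d-fixed : residual w c d ⟨$⟩ʳ d ≡ d
    d-fixed = begin
      w ⟨$⟩ʳ PC.transpose d c (PC.transpose 1F 0F d)
        ≡⟨ cong (λ y → w ⟨$⟩ʳ PC.transpose d c y)
             (transpose-fixes (above⇒≢ 2≤d) (above⇒≢ (≤-trans (s≤s z≤n) 2≤d))) ⟩
      w ⟨$⟩ʳ PC.transpose d c d   ≡⟨ cong (w ⟨$⟩ʳ_) (transpose-matchˡ d c) ⟩
      w ⟨$⟩ʳ c                    ≡⟨ wc≡d ⟩
      d                           ∎
    moved-fixed : InSym (suc m) (residual w c d)
    moved-fixed x m<x = begin
      w ⟨$⟩ʳ PC.transpose d c (PC.transpose 1F 0F x)
        ≡⟨ cong (λ y → w ⟨$⟩ʳ PC.transpose d c y)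
             (transpose-fixes (above⇒≢ 1<x) (above⇒≢ (<-trans (s≤s z≤n) 1<x))) ⟩
      w ⟨$⟩ʳ PC.transpose d c x
        ≡⟨ cong (w ⟨$⟩ʳ_) (transpose-fixes (above⇒≢ d<x) (above⇒≢ (<-trans c<d d<x))) ⟩
      w ⟨$⟩ʳ x                    ≡⟨ w∈S x m<x ⟩
      x                           ∎
      where
      d<x : toℕ d < toℕ x
      d<x = subst (_< toℕ x) (sym d≡m) m<x
      1<x : 1 < toℕ x
      1<x = ≤-<-trans (≤-trans (s≤s z≤n) 2≤d) d<x

  -- Every w ∈ Aₘ₊₁ ∩ Sₘ₊₁ (m ≥ 2) can be peeled.  With d the point of index m and c = w⁻¹(d):
  -- if c = d then w ∈ Sₘ and w = w · e; otherwise c < d and w = residual w c d · (1 2)(c d).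
  peel : ∀ {m} (w : Permutation′ N) (d : Fin N) → toℕ d ≡ m → 2 ≤ m → IsEven w → InSym (suc m) w →
    Peeling m w
  peel w d d≡m 2≤m w-even w∈S with w ⟨$⟩ˡ d ≟ d
  ... | yes c≡d =
    peeling w id w-even (InSym-step {σ = w} d d≡m w∈S wd≡d) (inj₁ (λ _ → refl)) (λ _ → refl)
    where
    wd≡d : w ⟨$⟩ʳ d ≡ d
    wd≡d = trans (cong (w ⟨$⟩ʳ_) (sym c≡d)) (inverseʳ w)
  ... | no c≢d = peeling (residual w c d) (rElem c d)
    (even-·-transpositions {w = w} w-even (≢-sym c≢d) (λ ()))
    (residual∈S w d≡m (subst (2 ≤_) (sym d≡m) 2≤m) c<d (inverseʳ w) w∈S)
    (rElem∈R d≡m c<d) (residual-factorises w c d)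
    where
    c = w ⟨$⟩ˡ d
    c<d = preimage-below w d d≡m w∈S c≢d

  decompose : ∀ m → 2 + m ≤ N → ∀ w → IsEven w → InSym (2 + m) w →
    Σ (ℕ → Permutation′ N) λ f → AllInR (2 + m) f × prod3 f (2 + m) ≈ w
  decompose zero _ w w-even w∈S =
    (λ _ → id) , (λ { i (s≤s (s≤s (s≤s _))) (s≤s (s≤s ())) }) ,
    λ x → sym (even-in-S₂-is-id {w = w} w-even w∈S x)
  decompose (suc m) 3+m≤N w w-even w∈S
    with peel w (fromℕ< 3+m≤N) (toℕ-fromℕ< 3+m≤N) (s≤s (s≤s z≤n)) w-even w∈S
  ... | peeling w′ ρ w′-even w′∈S ρ∈R w′ρ≈w
    with decompose m (≤-trans (n≤1+n _) 3+m≤N) w′ w′-even w′∈S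
  ... | f , f∈R , f≈w′ = extend f (3 + m) ρ , AllInR-extend (2 + m) f∈R ρ∈R , λ x → begin
    prod3 (extend f (3 + m) ρ) (3 + m) ⟨$⟩ʳ x  ≡⟨ cong (_⟨$⟩ʳ x) (prod3-extend m f ρ) ⟩
    prod3 f (2 + m) ⟨$⟩ʳ (ρ ⟨$⟩ʳ x)            ≡⟨ f≈w′ (ρ ⟨$⟩ʳ x) ⟩
    w′ ⟨$⟩ʳ (ρ ⟨$⟩ʳ x)                         ≡⟨ w′ρ≈w x ⟩
    w ⟨$⟩ʳ x                                   ∎

  -- The last factor of v₃ ⋯ v₃₊ₘ is determined by the product: v₃ ⋯ v₂₊ₘ fixes the point d
  -- of index 2 + m, so the product and its last factor have the same preimage of d.
  last-factor-determined : ∀ m {f g : ℕ → Permutation′ N} (d : Fin N) → toℕ d ≡ 2 + m →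
    AllInR (3 + m) f → AllInR (3 + m) g → prod3 f (3 + m) ≈ prod3 g (3 + m) → f (3 + m) ≈ g (3 + m)
  last-factor-determined m {f} {g} d d≡2+m f∈R g∈R f≈g =
    R-determined (f (3 + m)) (g (3 + m)) d d≡2+m (subst (2 ≤_) (sym d≡2+m) (m≤m+n 2 m))
      (f∈R (3 + m) (m≤m+n 3 m) ≤-refl) (g∈R (3 + m) (m≤m+n 3 m) ≤-refl) (begin
        f (3 + m) ⟨$⟩ˡ d
          ≡⟨ cong (f (3 + m) ⟨$⟩ˡ_) (sym (fixes-d f f∈R)) ⟩
        f (3 + m) ⟨$⟩ˡ (prod3 f (2 + m) ⟨$⟩ˡ d)
          ≡⟨ ≈-inverse (prod3 f (3 + m)) (prod3 g (3 + m)) f≈g d ⟩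
        g (3 + m) ⟨$⟩ˡ (prod3 g (2 + m) ⟨$⟩ˡ d)
          ≡⟨ cong (g (3 + m) ⟨$⟩ˡ_) (fixes-d g g∈R) ⟩
        g (3 + m) ⟨$⟩ˡ d
          ∎)
    where
    fixes-d : ∀ h → AllInR (3 + m) h → prod3 h (2 + m) ⟨$⟩ˡ d ≡ d
    fixes-d h h∈R = fixed-by-inverse (prod3 h (2 + m))
      (prod3∈S (2 + m) (AllInR-restrict {f = h} h∈R) d (≤-reflexive (sym d≡2+m)))

  factorisation-unique : ∀ m {f g : ℕ → Permutation′ N} → m ≤ N → AllInR m f → AllInR m g →
    prod3 f m ≈ prod3 g m → ∀ i → 3 ≤ i → i ≤ m → f i ≈ g i
  factorisation-unique (suc (suc (suc m))) {f} {g} 3+m≤N f∈R g∈R f≈g i 3≤i i≤3+m =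
    [ (λ i<3+m → factorisation-unique (suc (suc m)) (≤-trans (n≤1+n _) 3+m≤N)
                   (AllInR-restrict {f = f} f∈R) (AllInR-restrict {f = g} g∈R)
                   (·-cancelʳ {σ = prod3 f (2 + m)} {prod3 g (2 + m)} {f (3 + m)} {g (3 + m)}
                      f≈g last≈)
                   i 3≤i (s≤s⁻¹ i<3+m))
    , (λ i≡3+m → subst (λ j → f j ≈ g j) (sym i≡3+m) last≈)
    ]′ (m≤n⇒m<n∨m≡n i≤3+m)
    where
    last≈ : f (3 + m) ≈ g (3 + m)
    last≈ = last-factor-determined m (fromℕ< 3+m≤N) (toℕ-fromℕ< 3+m≤N) f∈R g∈R f≈g
  factorisation-unique zero                _ _ _ _ _ (s≤s _)             ()
  factorisation-unique (suc zero)          _ _ _ _ _ (s≤s (s≤s _))       (s≤s ())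
  factorisation-unique (suc (suc zero))    _ _ _ _ _ (s≤s (s≤s (s≤s _))) (s≤s (s≤s ()))

theorem4p2 : (n : ℕ) → 3 ≤ n → (v : Permutation′ n) → IsEven v →
    Σ (ℕ → Permutation′ n) λ f →
      (AllInR n f × (prod3 f n ≈ v)) ×
      ((g : ℕ → Permutation′ n) → AllInR n g → prod3 g n ≈ v →
        (i : ℕ) → 3 ≤ i → i ≤ n → g i ≈ f i)
theorem4p2 (suc (suc (suc k))) (s≤s (s≤s (s≤s _))) v v-even
  with decompose (suc k) ≤-refl v v-even (InSym-all v)
... | f , f∈R , f≈v =
  f , (f∈R , f≈v) ,
  λ g g∈R g≈v → factorisation-unique (3 + k) ≤-refl g∈R f∈R (λ x → trans (g≈v x) (sym (f≈v x)))
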